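{- Let $L$ be a residuated lattice and let $\mu:L\to[0,1]$ be a fuzzy subset of $L$. The following are equivalent: (i) $\mu$ is a fuzzy ideal of $L$; (ii) for all $x,y,z\in L$, if $(x\boxplus y)\boxplus z^{\ast}=1$ then $\mu(z)\ge\min(\mu(x),\mu(y))$; (iii) for all $x,y,z\in L$, if $z\preceq x\boxplus y$ then $\mu(z)\ge\min(\mu(x),\mu(y))$.
   Context: A residuated lattice is an algebra $(L,\vee,\wedge,\odot,\rightarrow,0,1)$ such that $(L,\vee,\wedge,0,1)$ is a bounded lattice (with lattice order $\preceq$), $(L,\odot,1)$ is a commutative monoid, and $x\odot z\preceq y$ iff $x\preceq z\rightarrow y$ for all $x,y,z\in L$. Notation: $x^{\ast}=x\rightarrow 0$, $x\boxplus y=x^{\ast}\rightarrow y^{\ast\ast}$, $x\uplus y=x^{\ast}\rightarrow y$. A fuzzy ideal of $L$ is a map $\mu:L\to[0,1]$ such that (a) $x\preceq y$ implies $\mu(x)\ge\mu(y)$, and (b) $\mu(x\uplus y)\ge\min(\mu(x),\mu(y))$ for all $x,y\in L$. -}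

module Defs where

open import Level using (Level; suc; _⊔_)
open import Relation.Binary.PropositionalEquality using (_≡_)
open import Relation.Binary.Bundles using (TotalOrder)
open import Data.Product using (_×_)
import Algebra.Construct.NaturalChoice.Min as Min

record ResiduatedLattice (c : Level) : Set (suc c) where
  infixr 6 _∨_
  infixr 7 _∧_
  infixr 7 _⊙_
  infixr 5 _⇒_
  infix 4 _≼_
  field
    Carrier : Set c
    _∨_ _∧_ _⊙_ _⇒_ : Carrier → Carrier → Carrier
    𝟘 𝟙 : Carrier
    ∨-assoc : ∀ x y z → (x ∨ y) ∨ z ≡ x ∨ (y ∨ z)
    ∨-comm  : ∀ x y → x ∨ y ≡ y ∨ x
    ∧-assoc : ∀ x y z → (x ∧ y) ∧ z ≡ x ∧ (y ∧ z)
    ∧-comm  : ∀ x y → x ∧ y ≡ y ∧ x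
    ∨-absorbs-∧ : ∀ x y → x ∨ (x ∧ y) ≡ x
    ∧-absorbs-∨ : ∀ x y → x ∧ (x ∨ y) ≡ x

  _≼_ : Carrier → Carrier → Set c
  x ≼ y = x ∧ y ≡ x

  field
    𝟘-least   : ∀ x → 𝟘 ≼ x
    𝟙-greatest : ∀ x → x ≼ 𝟙
    ⊙-assoc : ∀ x y z → (x ⊙ y) ⊙ z ≡ x ⊙ (y ⊙ z)
    ⊙-comm  : ∀ x y → x ⊙ y ≡ y ⊙ x
    ⊙-identityʳ : ∀ x → x ⊙ 𝟙 ≡ x
    residuated→ : ∀ x y z → x ⊙ z ≼ y → x ≼ z ⇒ y
    residuated← : ∀ x y z → x ≼ z ⇒ y → x ⊙ z ≼ y

  _* : Carrier → Carrier
  x * = x ⇒ 𝟘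

  _⊞_ : Carrier → Carrier → Carrier
  x ⊞ y = (x *) ⇒ ((y *) *)

  _⊎_ : Carrier → Carrier → Carrier
  x ⊎ y = (x *) ⇒ y

module _ {c a ℓ₁ ℓ₂} (L : ResiduatedLattice c) (I : TotalOrder a ℓ₁ ℓ₂) where
  open ResiduatedLattice L
  open TotalOrder I renaming (Carrier to V; _≤_ to _≤ᵛ_)
  open Min I using (_⊓_)

  IsFuzzyIdeal : (Carrier → V) → Set (c ⊔ ℓ₂)
  IsFuzzyIdeal μ =
    (∀ x y → x ≼ y → μ y ≤ᵛ μ x) ×
    (∀ x y → (μ x ⊓ μ y) ≤ᵛ μ (x ⊎ y))

  Cond-ii : (Carrier → V) → Set (c ⊔ ℓ₂)
  Cond-ii μ = ∀ x y z → (x ⊞ y) ⊞ (z *) ≡ 𝟙 → (μ x ⊓ μ y) ≤ᵛ μ z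

  Cond-iii : (Carrier → V) → Set (c ⊔ ℓ₂)
  Cond-iii μ = ∀ x y z → z ≼ x ⊞ y → (μ x ⊓ μ y) ≤ᵛ μ z

-- In a residuated lattice x ⊞ y = x* ⇒ y** equals (x* ⊙ y*)*, a negation, hence
-- regular: (x ⊞ y)** = x ⊞ y.  Since w ⊞ z* = 1 says exactly z ≼ w**, this makes
-- conditions (ii) and (iii) literally the same.  For (i) ⇔ (iii): a fuzzy ideal
-- satisfies μ y ≤ μ (y ⊎ 0) = μ y**, so min(μ x, μ y) ≤ μ (x ⊎ y**) = μ (x ⊞ y);
-- conversely x ⊎ y ≼ x ⊞ y and y ≼ y ⊞ y give the two ideal axioms from (iii).
module Submission where

open import Defs
open import Level using (0ℓ)
open import Data.Product using (_×_; _,_)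
open import Function using (_⇔_; mk⇔; Equivalence)
open import Relation.Binary.Bundles using (TotalOrder)
open import Relation.Binary.PropositionalEquality
  using (_≡_; refl; sym; trans; cong; subst; subst₂; module ≡-Reasoning)
import Algebra.Construct.NaturalChoice.Min as Min
import Relation.Binary.Reasoning.PartialOrder as PartialOrderReasoning

open Equivalence using (to; from)

module ResiduatedLatticeProperties {c} (L : ResiduatedLattice c) where
  open ResiduatedLattice L

  ≼-reflexive : ∀ {x y} → x ≡ y → x ≼ y
  ≼-reflexive {x} refl = trans (cong (x ∧_) (sym (∨-absorbs-∧ x x))) (∧-absorbs-∨ x (x ∧ x))

  ≼-refl : ∀ {x} → x ≼ x
  ≼-refl = ≼-reflexive refl

  ≼-trans : ∀ {x y z} → x ≼ y → y ≼ z → x ≼ z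
  ≼-trans {x} {y} {z} x≼y y≼z = begin
    x ∧ z        ≡⟨ cong (_∧ z) (sym x≼y) ⟩
    (x ∧ y) ∧ z  ≡⟨ ∧-assoc x y z ⟩
    x ∧ (y ∧ z)  ≡⟨ cong (x ∧_) y≼z ⟩
    x ∧ y        ≡⟨ x≼y ⟩
    x            ∎
    where open ≡-Reasoning

  ≼-antisym : ∀ {x y} → x ≼ y → y ≼ x → x ≡ y
  ≼-antisym {x} {y} x≼y y≼x = trans (sym x≼y) (trans (∧-comm x y) y≼x)

  ≡𝟙⇔𝟙≼ : ∀ {x} → x ≡ 𝟙 ⇔ 𝟙 ≼ x
  ≡𝟙⇔𝟙≼ {x} = mk⇔ (λ x≡𝟙 → ≼-reflexive (sym x≡𝟙)) (≼-antisym (𝟙-greatest x))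

  ⊙-identityˡ : ∀ x → 𝟙 ⊙ x ≡ x
  ⊙-identityˡ x = trans (⊙-comm 𝟙 x) (⊙-identityʳ x)

  ⊙-monoˡ : ∀ {x y} z → x ≼ y → x ⊙ z ≼ y ⊙ z
  ⊙-monoˡ {x} {y} z x≼y = residuated← x (y ⊙ z) z (≼-trans x≼y (residuated→ y (y ⊙ z) z ≼-refl))

  ⊙-monoʳ : ∀ {x y} z → x ≼ y → z ⊙ x ≼ z ⊙ y
  ⊙-monoʳ {x} {y} z x≼y =
    subst₂ _≼_ (⊙-comm x z) (⊙-comm y z) (⊙-monoˡ z x≼y)

  ⇒-elim : ∀ x y → (x ⇒ y) ⊙ x ≼ y
  ⇒-elim x y = residuated← (x ⇒ y) y x ≼-refl

  ⇒-monoʳ : ∀ {x y} z → x ≼ y → z ⇒ x ≼ z ⇒ y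
  ⇒-monoʳ {x} {y} z x≼y = residuated→ (z ⇒ x) y z (≼-trans (⇒-elim z x) x≼y)

  ⇒-antitoneˡ : ∀ {x y} z → x ≼ y → y ⇒ z ≼ x ⇒ z
  ⇒-antitoneˡ {x} {y} z x≼y = residuated→ (y ⇒ z) z x (≼-trans (⊙-monoʳ (y ⇒ z) x≼y) (⇒-elim y z))

  𝟙≼⇒⇔≼ : ∀ {x y} → 𝟙 ≼ x ⇒ y ⇔ x ≼ y
  𝟙≼⇒⇔≼ {x} {y} = mk⇔
    (λ 𝟙≼x⇒y → subst (_≼ y) (⊙-identityˡ x) (residuated← 𝟙 y x 𝟙≼x⇒y))
    (λ x≼y → residuated→ 𝟙 y x (subst (_≼ y) (sym (⊙-identityˡ x)) x≼y))

  *-antitone : ∀ {x y} → x ≼ y → y * ≼ x *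
  *-antitone = ⇒-antitoneˡ 𝟘

  *-galois : ∀ {x y} → x ≼ y * → y ≼ x *
  *-galois {x} {y} x≼y* =
    residuated→ y 𝟘 x (subst (_≼ 𝟘) (⊙-comm x y) (residuated← x 𝟘 y x≼y*))

  x≼x** : ∀ x → x ≼ x * *
  x≼x** x = *-galois ≼-refl

  ***≡* : ∀ x → x * * * ≡ x *
  ***≡* x = ≼-antisym (*-antitone (x≼x** x)) (x≼x** (x *))

  ⇒*≡⊙* : ∀ x y → x ⇒ y * ≡ (x ⊙ y) *
  ⇒*≡⊙* x y = ≼-antisym
    (residuated→ (x ⇒ y *) 𝟘 (x ⊙ y)
      (subst (_≼ 𝟘) (⊙-assoc (x ⇒ y *) x y)
        (≼-trans (⊙-monoˡ y (⇒-elim x (y *))) (⇒-elim y 𝟘))))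
    (residuated→ ((x ⊙ y) *) (y *) x
      (residuated→ (((x ⊙ y) *) ⊙ x) 𝟘 y
        (subst (_≼ 𝟘) (sym (⊙-assoc ((x ⊙ y) *) x y)) (⇒-elim (x ⊙ y) 𝟘))))

  ⊞-regular : ∀ x y → (x ⊞ y) * * ≡ x ⊞ y
  ⊞-regular x y = begin
    (x ⊞ y) * *            ≡⟨ cong (λ w → w * *) (⇒*≡⊙* (x *) (y *)) ⟩
    ((x * ⊙ y *) *) * *    ≡⟨ ***≡* (x * ⊙ y *) ⟩
    (x * ⊙ y *) *          ≡⟨ sym (⇒*≡⊙* (x *) (y *)) ⟩
    x ⊞ y                  ∎
    where open ≡-Reasoning

  ⊞*≡𝟙⇔≼** : ∀ w z → w ⊞ (z *) ≡ 𝟙 ⇔ z ≼ w * *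
  ⊞*≡𝟙⇔≼** w z = mk⇔
    (λ eq → *-galois (subst (w * ≼_) (***≡* z) (to 𝟙≼⇒⇔≼ (to ≡𝟙⇔𝟙≼ eq))))
    (λ z≼w** → from ≡𝟙⇔𝟙≼ (from 𝟙≼⇒⇔≼ (subst (w * ≼_) (sym (***≡* z)) (*-galois z≼w**))))

  ⊞⊞*≡𝟙⇔≼⊞ : ∀ x y z → (x ⊞ y) ⊞ (z *) ≡ 𝟙 ⇔ z ≼ x ⊞ y
  ⊞⊞*≡𝟙⇔≼⊞ x y z = subst (λ w → (x ⊞ y) ⊞ (z *) ≡ 𝟙 ⇔ z ≼ w) (⊞-regular x y) (⊞*≡𝟙⇔≼** (x ⊞ y) z)

  ⊎≼⊞ : ∀ x y → x ⊎ y ≼ x ⊞ y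
  ⊎≼⊞ x y = ⇒-monoʳ (x *) (x≼x** y)

  x≼x⊞x : ∀ x → x ≼ x ⊞ x
  x≼x⊞x x = ≼-trans (x≼x** x) (⇒-monoʳ (x *) (𝟘-least (x * *)))

module FuzzyIdealProperties {c} (L : ResiduatedLattice c) (I : TotalOrder 0ℓ 0ℓ 0ℓ)
    (μ : ResiduatedLattice.Carrier L → TotalOrder.Carrier I) where
  open ResiduatedLattice L
  open ResiduatedLatticeProperties L
  open TotalOrder I using (poset) renaming (_≤_ to _≤ᵛ_; refl to ≤ᵛ-refl; trans to ≤ᵛ-trans)
  open Min I using (_⊓_; ⊓-glb; ⊓-monoʳ-≤)
  open PartialOrderReasoning poset

  μ-≤-μ** : IsFuzzyIdeal L I μ → ∀ x → μ x ≤ᵛ μ (x * *)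
  μ-≤-μ** (antitone , ⊎-closed) x = ≤ᵛ-trans (⊓-glb ≤ᵛ-refl (antitone 𝟘 x (𝟘-least x))) (⊎-closed x 𝟘)

  isFuzzyIdeal⇒cond-iii : IsFuzzyIdeal L I μ → Cond-iii L I μ
  isFuzzyIdeal⇒cond-iii ideal@(antitone , ⊎-closed) x y z z≼x⊞y = begin
    μ x ⊓ μ y          ≤⟨ ⊓-monoʳ-≤ (μ x) (μ-≤-μ** ideal y) ⟩
    μ x ⊓ μ (y * *)    ≤⟨ ⊎-closed x (y * *) ⟩
    μ (x ⊞ y)          ≤⟨ antitone z (x ⊞ y) z≼x⊞y ⟩
    μ z                ∎

  cond-iii⇒isFuzzyIdeal : Cond-iii L I μ → IsFuzzyIdeal L I μ
  cond-iii⇒isFuzzyIdeal cond =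
    (λ x y x≼y → ≤ᵛ-trans (⊓-glb ≤ᵛ-refl ≤ᵛ-refl) (cond y y x (≼-trans x≼y (x≼x⊞x y)))) ,
    (λ x y → cond x y (x ⊎ y) (⊎≼⊞ x y))

  cond-ii⇔cond-iii : Cond-ii L I μ ⇔ Cond-iii L I μ
  cond-ii⇔cond-iii = mk⇔
    (λ cond x y z z≼x⊞y → cond x y z (from (⊞⊞*≡𝟙⇔≼⊞ x y z) z≼x⊞y))
    (λ cond x y z eq → cond x y z (to (⊞⊞*≡𝟙⇔≼⊞ x y z) eq))

proposition2 : ∀ {c} (L : ResiduatedLattice c) (I : TotalOrder 0ℓ 0ℓ 0ℓ)
    (μ : ResiduatedLattice.Carrier L → TotalOrder.Carrier I) →
    ((IsFuzzyIdeal L I μ → Cond-ii L I μ) × (Cond-ii L I μ → IsFuzzyIdeal L I μ)) ×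
    ((IsFuzzyIdeal L I μ → Cond-iii L I μ) × (Cond-iii L I μ → IsFuzzyIdeal L I μ))
proposition2 L I μ =
  ( (λ ideal → from cond-ii⇔cond-iii (isFuzzyIdeal⇒cond-iii ideal))
  , (λ cond → cond-iii⇒isFuzzyIdeal (to cond-ii⇔cond-iii cond)) )
  , (isFuzzyIdeal⇒cond-iii , cond-iii⇒isFuzzyIdeal)
  where open FuzzyIdealProperties L I μ
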